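{- Let $s$ and $m$ be positive integers, let $n=m^s$, and let $k$ be a positive integer that is a multiple of $m\prod_{p\mid m}p$ (product over the distinct primes dividing $m$). Then $$n\,2^{\omega(k)} = 2^{\omega\left(\frac{k^s}{(k^s,n)_s}\right)}\,(k^s,n)_s .$$
   Context: For positive integers $a,b,s$, the generalized gcd $(a,b)_s$ is the largest $d^s$ ($d\in\mathbb{N}$) such that $d^s\mid a$ and $d^s\mid b$. $\omega(k)$ denotes the number of distinct prime divisors of $k$. -}

module Defs where

open import Data.Nat using (ℕ; zero; suc; _*_; _^_; _/_; NonZero)
open import Data.Nat.Properties using (m^n≢0)
open import Data.Nat.Divisibility using (_∣?_)
open import Data.Nat.Primality using (prime?)
open import Data.Nat.ListAction using (product)
open import Data.List using (List; length; filter; upTo)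
open import Relation.Nullary.Decidable using (_×-dec_; does)
open import Data.Bool using (if_then_else_)

-- the distinct primes dividing k, listed from {0, …, k}
-- (for k ≥ 1 every prime divisor of k is ≤ k)
primeDivisors : ℕ → List ℕ
primeDivisors k = filter (λ p → prime? p ×-dec (p ∣? k)) (upTo (suc k))

ω : ℕ → ℕ
ω k = length (primeDivisors k)

rad : ℕ → ℕ
rad m = product (primeDivisors m)

-- searchP s a b d returns (D - 1) where D is the largest element of
-- {1, …, d} with D^s ∣ a and D^s ∣ b (D = 1 always qualifies).
searchP : ℕ → ℕ → ℕ → ℕ → ℕ
searchP s a b zero = 0
searchP s a b (suc d) =
  if does ((suc d ^ s ∣? a) ×-dec (suc d ^ s ∣? b))
  then d
  else searchP s a b d

-- largest d ≥ 1 with d^s ∣ a and d^s ∣ b.  For a ≥ 1, s ≥ 1 any such d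
-- satisfies d ≤ a, so searching {1, …, a} is exhaustive.
gcdBase : ℕ → ℕ → ℕ → ℕ
gcdBase s a b = suc (searchP s a b a)

genGcd : ℕ → ℕ → ℕ → ℕ
genGcd s a b = gcdBase s a b ^ s

divGenGcd : ℕ → ℕ → ℕ → ℕ
divGenGcd s a b = _/_ a (genGcd s a b) {{m^n≢0 (gcdBase s a b) s}}

module Submission where

-- Write k = q m; since every prime dividing m divides rad m, and rad m ∣ q, the numbers q, k = q m
-- and q ^ s all have the same prime divisors.  As m ^ s ∣ k ^ s and no D > m has D ^ s ∣ m ^ s, the
-- generalized gcd (k ^ s , m ^ s)_s is m ^ s itself, and the quotient k ^ s / m ^ s is q ^ s.

open import Defs
open import Data.List using ([]; [_]; _++_; length; filter; upTo)
open import Data.List.Properties using (upTo-∷ʳ; filter-++; filter-reject; filter-≐; ++-identityʳ)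
open import Data.List.Membership.Propositional.Properties using (∈-filter⁺; ∈-upTo⁺)
open import Data.Nat using (ℕ; zero; suc; _+_; _*_; _^_; _≤_; _<_; NonZero; s≤s; z≤n)
open import Data.Nat.DivMod using (/-congʳ; m*n/n≡m)
open import Data.Nat.Divisibility
open import Data.Nat.ListAction.Properties using (∈⇒∣product)
open import Data.Nat.Primality using (Prime; prime?; euclidsLemma; ¬prime[1])
open import Data.Nat.Properties
open import Data.Product using (_×_; _,_)
open import Data.Sum using (inj₁; inj₂)
open import Function using (_∘_; it)
open import Relation.Nullary using (¬_; yes; no; contradiction)
open import Relation.Nullary.Decidable using (_×-dec_)
open import Relation.Unary using (Decidable; _≐_)
open import Relation.Binary.PropositionalEquality hiding ([_])

open ≡-Reasoning

^-distribʳ-* : ∀ m n o → (m * n) ^ o ≡ m ^ o * n ^ o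
^-distribʳ-* m n zero    = refl
^-distribʳ-* m n (suc o) = begin
  m * n * (m * n) ^ o       ≡⟨ cong (m * n *_) (^-distribʳ-* m n o) ⟩
  m * n * (m ^ o * n ^ o)   ≡⟨ [m*n]*[o*p]≡[m*o]*[n*p] m n (m ^ o) (n ^ o) ⟩
  m * m ^ o * (n * n ^ o)   ∎

searchP-≡ : ∀ s a b d → suc d ^ s ∣ a → suc d ^ s ∣ b
  → (∀ D → suc d < D → ¬ (D ^ s ∣ a × D ^ s ∣ b))
  → ∀ N → d ≤ N → searchP s a b (suc N) ≡ d
searchP-≡ s a b d d^s∣a d^s∣b maximal N d≤N with m≤n⇒m<n∨m≡n d≤N
... | inj₂ refl with suc d ^ s ∣? a | suc d ^ s ∣? b
...   | yes _      | yes _      = refl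
...   | no ¬d^s∣a  | _          = contradiction d^s∣a ¬d^s∣a
...   | yes _      | no ¬d^s∣b  = contradiction d^s∣b ¬d^s∣b
searchP-≡ s a b d d^s∣a d^s∣b maximal (suc N) _ | inj₁ (s≤s d≤N)
  with suc (suc N) ^ s ∣? a | suc (suc N) ^ s ∣? b
... | yes N^s∣a | yes N^s∣b = contradiction (N^s∣a , N^s∣b) (maximal (suc (suc N)) (s≤s (s≤s d≤N)))
... | yes _     | no _      = searchP-≡ s a b d d^s∣a d^s∣b maximal N d≤N
... | no _      | _         = searchP-≡ s a b d d^s∣a d^s∣b maximal N d≤N

gcdBase-≡ : ∀ s a b d .{{_ : NonZero d}} → d ^ s ∣ a → d ^ s ∣ b
  → (∀ D → d < D → ¬ (D ^ s ∣ a × D ^ s ∣ b)) → d ≤ a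
  → gcdBase s a b ≡ d
gcdBase-≡ s a@(suc a′) b (suc d) d^s∣a d^s∣b maximal (s≤s d≤a′) =
  cong suc (searchP-≡ s a b d d^s∣a d^s∣b maximal a′ d≤a′)

m≤m^n : ∀ m n .{{_ : NonZero m}} .{{_ : NonZero n}} → m ≤ m ^ n
m≤m^n m n@(suc _) = subst (_≤ m ^ n) (^-identityʳ m) (^-monoʳ-≤ m {1} {n} (s≤s z≤n))

gcdBase-of-^-∣ : ∀ s a m .{{_ : NonZero s}} .{{_ : NonZero a}} .{{_ : NonZero m}}
  → m ^ s ∣ a → gcdBase s a (m ^ s) ≡ m
gcdBase-of-^-∣ s a m m^s∣a = gcdBase-≡ s a (m ^ s) m m^s∣a ∣-refl
  (λ D m<D (_ , D^s∣m^s) → >⇒∤ (^-monoˡ-< s m<D) D^s∣m^s)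
  (≤-trans (m≤m^n m s) (∣⇒≤ m^s∣a))
  where instance _ = m^n≢0 m s

module _ (s c m : ℕ) .{{_ : NonZero s}} .{{_ : NonZero c}} .{{_ : NonZero m}} where
  instance
    _ = m^n≢0 m s
    _ = m*n≢0 c (m ^ s)

  genGcd-*-^ : genGcd s (c * m ^ s) (m ^ s) ≡ m ^ s
  genGcd-*-^ = cong (_^ s) (gcdBase-of-^-∣ s (c * m ^ s) m (n∣m*n c))

  divGenGcd-*-^ : divGenGcd s (c * m ^ s) (m ^ s) ≡ c
  divGenGcd-*-^ = trans (/-congʳ {{m^n≢0 (gcdBase s (c * m ^ s) (m ^ s)) s}} genGcd-*-^) (m*n/n≡m c (m ^ s))

isPrimeDivisor? : ∀ x → Decidable (λ p → Prime p × p ∣ x)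
isPrimeDivisor? x p = prime? p ×-dec (p ∣? x)

-- The bound is written j + suc x so that each step in j unfolds definitionally.
filter-upTo-primeDivisors : ∀ x .{{_ : NonZero x}} j
  → filter (isPrimeDivisor? x) (upTo (j + suc x)) ≡ primeDivisors x
filter-upTo-primeDivisors x zero = refl
filter-upTo-primeDivisors x (suc j) = begin
  filter P? (upTo (suc N))            ≡⟨ cong (filter P?) (upTo-∷ʳ N) ⟨
  filter P? (upTo N ++ [ N ])         ≡⟨ filter-++ P? (upTo N) [ N ] ⟩
  filter P? (upTo N) ++ filter P? [ N ] ≡⟨ cong (filter P? (upTo N) ++_) N∉ ⟩
  filter P? (upTo N) ++ []            ≡⟨ ++-identityʳ _ ⟩
  filter P? (upTo N)                  ≡⟨ filter-upTo-primeDivisors x j ⟩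
  primeDivisors x                     ∎
  where
  N = j + suc x
  P? = isPrimeDivisor? x
  N∉ : filter P? [ N ] ≡ []
  N∉ = filter-reject P? (λ (_ , N∣x) → >⇒∤ (m≤n+m (suc x) j) N∣x)

ω-cong : ∀ x y .{{_ : NonZero x}} .{{_ : NonZero y}}
  → (∀ {p} → Prime p → p ∣ x → p ∣ y) → (∀ {p} → Prime p → p ∣ y → p ∣ x)
  → ω x ≡ ω y
ω-cong x y x⇒y y⇒x = cong length (begin
  primeDivisors x                                   ≡⟨ filter-upTo-primeDivisors x y ⟨
  filter (isPrimeDivisor? x) (upTo (y + suc x))     ≡⟨ filter-≐ (isPrimeDivisor? x) (isPrimeDivisor? y) same (upTo (y + suc x)) ⟩
  filter (isPrimeDivisor? y) (upTo (y + suc x))     ≡⟨ cong (filter (isPrimeDivisor? y) ∘ upTo) bound-comm ⟩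
  filter (isPrimeDivisor? y) (upTo (x + suc y))     ≡⟨ filter-upTo-primeDivisors y x ⟩
  primeDivisors y                                   ∎)
  where
  same : (λ p → Prime p × p ∣ x) ≐ (λ p → Prime p × p ∣ y)
  same = (λ (pp , p∣x) → pp , x⇒y pp p∣x) , (λ (pp , p∣y) → pp , y⇒x pp p∣y)
  bound-comm : y + suc x ≡ x + suc y
  bound-comm = trans (+-suc y x) (trans (cong suc (+-comm y x)) (sym (+-suc x y)))

prime∣^⇒∣ : ∀ {p} m n → Prime p → p ∣ m ^ n → p ∣ m
prime∣^⇒∣ m zero    pp p∣1 = contradiction (subst Prime (∣1⇒≡1 p∣1) pp) ¬prime[1]
prime∣^⇒∣ m (suc n) pp p∣m^[1+n] with euclidsLemma m (m ^ n) pp p∣m^[1+n]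
... | inj₁ p∣m   = p∣m
... | inj₂ p∣m^n = prime∣^⇒∣ m n pp p∣m^n

prime∣⇒∣rad : ∀ {p} m .{{_ : NonZero m}} → Prime p → p ∣ m → p ∣ rad m
prime∣⇒∣rad m pp p∣m = ∈⇒∣product (∈-filter⁺ (isPrimeDivisor? m) (∈-upTo⁺ (s≤s (∣⇒≤ p∣m))) (pp , p∣m))

ω-^ : ∀ m n .{{_ : NonZero m}} .{{_ : NonZero n}} → ω (m ^ n) ≡ ω m
ω-^ m n@(suc n′) = ω-cong (m ^ n) m {{m^n≢0 m n}} (λ pp → prime∣^⇒∣ m n pp) (λ _ → ∣m⇒∣m*n (m ^ n′))

ω-*-rad : ∀ q m .{{_ : NonZero q}} .{{_ : NonZero m}} → rad m ∣ q → ω (q * m) ≡ ω q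
ω-*-rad q m rad∣q = ω-cong (q * m) q {{m*n≢0 q m}} prime∣qm⇒∣q (λ _ → ∣m⇒∣m*n m)
  where
  prime∣qm⇒∣q : ∀ {p} → Prime p → p ∣ q * m → p ∣ q
  prime∣qm⇒∣q pp p∣qm with euclidsLemma q m pp p∣qm
  ... | inj₁ p∣q = p∣q
  ... | inj₂ p∣m = ∣-trans (prime∣⇒∣rad m pp p∣m) rad∣q

corollary1 : (s m k : ℕ) → .{{_ : NonZero s}} → .{{_ : NonZero m}} → .{{_ : NonZero k}}
    → (m * rad m) ∣ k
    → (m ^ s) * 2 ^ ω k ≡ 2 ^ ω (divGenGcd s (k ^ s) (m ^ s)) * genGcd s (k ^ s) (m ^ s)
corollary1 s m k (divides c k≡c*[m*rad]) = begin
  m ^ s * 2 ^ ω k                    ≡⟨ *-comm (m ^ s) _ ⟩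
  2 ^ ω k * m ^ s                    ≡⟨ cong (λ e → 2 ^ e * m ^ s) ω-k≡ω-q^s ⟩
  2 ^ ω (q ^ s) * m ^ s              ≡⟨ cong₂ (λ a b → 2 ^ ω a * b) divGenGcd≡q^s genGcd≡m^s ⟨
  2 ^ ω (divGenGcd s (k ^ s) (m ^ s)) * genGcd s (k ^ s) (m ^ s) ∎
  where
  q = c * rad m
  k≡q*m : k ≡ q * m
  k≡q*m = trans k≡c*[m*rad] (trans (cong (c *_) (*-comm m (rad m))) (sym (*-assoc c (rad m) m)))
  instance
    _ = m*n≢0⇒m≢0 q {{subst NonZero k≡q*m it}}
    _ = m^n≢0 q s
  k^s≡q^s*m^s : k ^ s ≡ q ^ s * m ^ s
  k^s≡q^s*m^s = trans (cong (_^ s) k≡q*m) (^-distribʳ-* q m s)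
  genGcd≡m^s : genGcd s (k ^ s) (m ^ s) ≡ m ^ s
  genGcd≡m^s = trans (cong (λ a → genGcd s a (m ^ s)) k^s≡q^s*m^s) (genGcd-*-^ s (q ^ s) m)
  divGenGcd≡q^s : divGenGcd s (k ^ s) (m ^ s) ≡ q ^ s
  divGenGcd≡q^s = trans (cong (λ a → divGenGcd s a (m ^ s)) k^s≡q^s*m^s) (divGenGcd-*-^ s (q ^ s) m)
  ω-k≡ω-q^s : ω k ≡ ω (q ^ s)
  ω-k≡ω-q^s = trans (cong ω k≡q*m) (trans (ω-*-rad q m (divides c refl)) (sym (ω-^ q s)))
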